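{- Let $G$ be a connected graph and $D$ a rooted distribution on $G$ with root $r$. If $D$ is $r$-critical and greedy, then $w(D)=1$.
   Context: A pebbling distribution assigns to each vertex $v$ a non-negative integer $D(v)$ of pebbles; a rooted distribution fixes a root $r$. A pebbling step $[a,b]$, for adjacent $a,b$, removes two pebbles from $a$ and adds one to $b$; it is greedy if $d(a,r)>d(b,r)$ ($d$ = graph distance). $D$ is $r$-solvable if some sequence of pebbling steps (a solution) ends with at least one pebble on $r$; $D$ is $r$-critical if it is $r$-solvable but removing any single pebble makes it not $r$-solvable; $D$ is greedy if it has a solution using only greedy pebbling steps. The weight is $w(D)=\sum_{v} D(v)/2^{d(v,r)}$. -}

module Defs where

open import Data.Nat using (ℕ; zero; suc; _+_; _∸_; _^_; _≤_; _<_; _>_; _≥_)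
open import Data.Nat.Properties using (m^n≢0)
open import Data.Fin using (Fin; _≟_)
open import Data.Integer using (+_)
open import Data.Rational using (ℚ; _/_) renaming (_+_ to _+ℚ_; 0ℚ to 0ℚ)
open import Data.Product using (Σ; ∃; _×_; _,_)
open import Data.Empty using (⊥)
open import Relation.Nullary using (¬_; yes; no)
open import Relation.Binary.PropositionalEquality using (_≡_)
open import Relation.Binary.Construct.Closure.ReflexiveTransitive using (Star)
open import Level using (0ℓ)

record Graph : Set₁ where
  field
    n     : ℕ
    Adj   : Fin n → Fin n → Set
    sym   : ∀ {u v} → Adj u v → Adj v u
    irrefl : ∀ {u} → ¬ Adj u u

module _ (G : Graph) where
  open Graph G

  data Walk : Fin n → Fin n → ℕ → Set where
    here : ∀ {u} → Walk u u zero
    step : ∀ {u w v k} → Adj u w → Walk w v k → Walk u v (suc k)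

  Connected : Set
  Connected = ∀ u v → ∃ λ k → Walk u v k

  IsDistanceTo : Fin n → (Fin n → ℕ) → Set
  IsDistanceTo r dist = ∀ v → Walk v r (dist v) × (∀ m → Walk v r m → dist v ≤ m)

  Distribution : Set
  Distribution = Fin n → ℕ

  applyStep : Fin n → Fin n → Distribution → Distribution
  applyStep a b D v with v ≟ a | v ≟ b
  ... | yes _ | _     = D v ∸ 2
  ... | no _  | yes _ = suc (D v)
  ... | no _  | no _  = D v

  data PStep : Distribution → Distribution → Set where
    pstep : ∀ {D} a b → Adj a b → D a ≥ 2 → PStep D (applyStep a b D)

  data GStep (dist : Fin n → ℕ) : Distribution → Distribution → Set where
    gstep : ∀ {D} a b → Adj a b → D a ≥ 2 → dist a > dist b →
            GStep dist D (applyStep a b D)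

  Solvable : Fin n → Distribution → Set
  Solvable r D = ∃ λ D' → Star PStep D D' × D' r ≥ 1

  GreedySolvable : (Fin n → ℕ) → Fin n → Distribution → Set
  GreedySolvable dist r D = ∃ λ D' → Star (GStep dist) D D' × D' r ≥ 1

  removeOne : Fin n → Distribution → Distribution
  removeOne u D v with v ≟ u
  ... | yes _ = D v ∸ 1
  ... | no _  = D v

  Critical : Fin n → Distribution → Set
  Critical r D = Solvable r D × (∀ u → D u ≥ 1 → ¬ Solvable r (removeOne u D))

  sumℚ : ∀ {m} → (Fin m → ℚ) → ℚ
  sumℚ {zero}  f = 0ℚ
  sumℚ {suc m} f = f Fin.zero +ℚ sumℚ (λ i → f (Fin.suc i))

  weight : (Fin n → ℕ) → Distribution → ℚ
  weight dist D = sumℚ (λ v → _/_ (+ D v) (2 ^ dist v) {{m^n≢0 2 (dist v)}})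

module Submission where

-- Run a greedy solution of D backwards while maintaining a solvable distribution C ≤ D
-- of weight 1, starting from one pebble on r.  To undo a greedy step [a,b]: if C uses
-- at most D(b) pebbles on b then C ≤ D already; otherwise replace one pebble of C on b
-- by two on a.  Since d(a) = d(b) + 1 this keeps the weight, and C is recovered from the
-- new distribution by the step [a,b], so it stays solvable.  Criticality of D then
-- forces C = D, so w(D) = w(C) = 1.

open import Defs
open import Data.Nat using (ℕ; zero; suc; _+_; _*_; _^_; _≤_; _<_; _>_; z≤n; s≤s; NonZero)
import Data.Nat.Properties as ℕ
import Data.Fin as F
open import Data.Fin using (Fin; _≟_; punchIn)
open import Data.Fin.Properties using (punchInᵢ≢i)
import Data.Integer as ℤ
import Data.Integer.Properties as ℤ
open import Data.Integer.Tactic.RingSolver using (solve-∀)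
open import Data.Rational as ℚ using (ℚ; _/_; 0ℚ; 1ℚ; fromℚᵘ)
import Data.Rational.Properties as ℚ
open import Data.Rational.Unnormalised as ℚᵘ using (mkℚᵘ; *≡*)
import Data.Rational.Unnormalised.Properties as ℚᵘ
open import Algebra.Properties.CommutativeSemigroup ℕ.+-commutativeSemigroup using (xy∙z≈xz∙y)
open import Algebra.Properties.Group ℚ.+-0-group using (∙-cancelʳ)
open import Algebra.Properties.CommutativeMonoid.Sum ℚ.+-0-commutativeMonoid
  using (sum; sum-cong-≗; ∑-distrib-+; sum-remove; sum-replicate-zero)
open import Function using (_∘_)
open import Data.Product using (_,_; proj₁; proj₂)
open import Relation.Binary.Construct.Closure.ReflexiveTransitive using (Star; ε; _◅_)
open import Relation.Nullary using (yes; no; contradiction)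
open import Relation.Binary.PropositionalEquality
  using (_≡_; refl; sym; trans; cong; cong₂; subst; _≢_; _≗_; module ≡-Reasoning)

fromℚᵘ-homo-+ : ∀ p q → fromℚᵘ (p ℚᵘ.+ q) ≡ fromℚᵘ p ℚ.+ fromℚᵘ q
fromℚᵘ-homo-+ p q = ℚ.toℚᵘ-injective (ℚᵘ.≃-trans
  (ℚ.toℚᵘ-fromℚᵘ (p ℚᵘ.+ q))
  (ℚᵘ.≃-sym (ℚᵘ.≃-trans (ℚ.toℚᵘ-homo-+ (fromℚᵘ p) (fromℚᵘ q))
                        (ℚᵘ.+-cong (ℚ.toℚᵘ-fromℚᵘ p) (ℚ.toℚᵘ-fromℚᵘ q)))))

i/n+j/n≡[i+j]/n : ∀ i j n .{{_ : NonZero n}} → i / n ℚ.+ j / n ≡ (i ℤ.+ j) / n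
i/n+j/n≡[i+j]/n i j (suc n) = trans (sym (fromℚᵘ-homo-+ (mkℚᵘ i n) (mkℚᵘ j n)))
  (ℚ.fromℚᵘ-cong {mkℚᵘ i n ℚᵘ.+ mkℚᵘ j n} {mkℚᵘ (i ℤ.+ j) n}
    (*≡* (trans (cross-multiply i j (ℤ.+ suc n))
                (cong ((i ℤ.+ j) ℤ.*_) (sym (ℤ.pos-* (suc n) (suc n)))))))
  where
  cross-multiply : ∀ a b c → (a ℤ.* c ℤ.+ b ℤ.* c) ℤ.* c ≡ (a ℤ.+ b) ℤ.* (c ℤ.* c)
  cross-multiply = solve-∀

2/[2*n]≡1/n : ∀ n .{{_ : NonZero n}} .{{_ : NonZero (2 * n)}} →
              (ℤ.+ 2) / (2 * n) ≡ (ℤ.+ 1) / n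
2/[2*n]≡1/n (suc n) = ℚ.fromℚᵘ-cong {mkℚᵘ (ℤ.+ 2) _} {mkℚᵘ (ℤ.+ 1) n}
  (*≡* (trans (sym (ℤ.pos-* 2 (suc n))) (sym (ℤ.*-identityˡ _))))

infix 7 _/2^_

_/2^_ : ℕ → ℕ → ℚ
k /2^ d = ((ℤ.+ k) / 2 ^ d) {{ℕ.m^n≢0 2 d}}

m/2^d+n/2^d≡[m+n]/2^d : ∀ m n d → m /2^ d ℚ.+ n /2^ d ≡ (m + n) /2^ d
m/2^d+n/2^d≡[m+n]/2^d m n d = i/n+j/n≡[i+j]/n (ℤ.+ m) (ℤ.+ n) (2 ^ d) {{ℕ.m^n≢0 2 d}}

0/2^d≡0 : ∀ d → 0 /2^ d ≡ 0ℚ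
0/2^d≡0 d = ℚ.0/n≡0 (2 ^ d) {{ℕ.m^n≢0 2 d}}

2/2^[1+d]≡1/2^d : ∀ d → 2 /2^ suc d ≡ 1 /2^ d
2/2^[1+d]≡1/2^d d = 2/[2*n]≡1/n (2 ^ d) {{ℕ.m^n≢0 2 d}} {{ℕ.m^n≢0 2 (suc d)}}

sum-concentrated : ∀ {m} (f : Fin m → ℚ) i → (∀ j → j ≢ i → f j ≡ 0ℚ) → sum f ≡ f i
sum-concentrated {suc m} f i f≡0 = begin
  sum f                            ≡⟨ sum-remove {i = i} f ⟩
  f i ℚ.+ sum {m} (f ∘ punchIn i)  ≡⟨ cong (f i ℚ.+_) (sum-cong-≗ (f≡0 _ ∘ punchInᵢ≢i i)) ⟩
  f i ℚ.+ sum {m} (λ _ → 0ℚ)       ≡⟨ cong (f i ℚ.+_) (sum-replicate-zero m) ⟩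
  f i ℚ.+ 0ℚ                       ≡⟨ ℚ.+-identityʳ (f i) ⟩
  f i                              ∎
  where open ≡-Reasoning

sumℚ≡sum : ∀ G {m} (f : Fin m → ℚ) → sumℚ G f ≡ sum f
sumℚ≡sum G {zero}  f = refl
sumℚ≡sum G {suc m} f = cong (f F.zero ℚ.+_) (sumℚ≡sum G (f ∘ F.suc))

module Pebbling (G : Graph) where
  open Graph G using (n; Adj; irrefl)

  private variable
    r a b u : Fin n
    D D' E F : Distribution G

  infixl 6 _⊕_
  infix 4 _≤ᴰ_

  _⊕_ : Distribution G → Distribution G → Distribution G
  (D ⊕ E) v = D v + E v

  _≤ᴰ_ : Distribution G → Distribution G → Set
  D ≤ᴰ E = ∀ v → D v ≤ E v

  single : Fin n → ℕ → Distribution G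
  single u k v with v ≟ u
  ... | yes _ = k
  ... | no _  = 0

  single-self : ∀ u k → single u k u ≡ k
  single-self u k with u ≟ u
  ... | yes _   = refl
  ... | no u≢u  = contradiction refl u≢u

  single-other : ∀ {u v} k → v ≢ u → single u k v ≡ 0
  single-other {u} {v} k v≢u with v ≟ u
  ... | yes v≡u = contradiction v≡u v≢u
  ... | no _    = refl

  single-≤ : ∀ {k} → k ≤ D u → single u k ≤ᴰ D
  single-≤ {u = u} k≤Du v with v ≟ u
  ... | yes refl = k≤Du
  ... | no _     = z≤n

  ⊕-cancelʳ-≤ : D ⊕ F ≤ᴰ E ⊕ F → D ≤ᴰ E
  ⊕-cancelʳ-≤ {F = F} le v = ℕ.+-cancelʳ-≤ (F v) _ _ (le v)

  ⊕-cancelʳ-≗ : D ⊕ F ≗ E ⊕ F → D ≗ E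
  ⊕-cancelʳ-≗ {F = F} eq v = ℕ.+-cancelʳ-≡ (F v) _ _ (eq v)

  adjacent⇒≢ : Adj a b → a ≢ b
  adjacent⇒≢ a~b refl = irrefl a~b

  removeOne-⊕-single : 1 ≤ D u → removeOne G u D ⊕ single u 1 ≗ D
  removeOne-⊕-single {u = u} 1≤Du v with v ≟ u
  ... | yes refl = ℕ.m∸n+n≡m 1≤Du
  ... | no _     = ℕ.+-identityʳ _

  ≤ᴰ-removeOne : E u < D u → E ≤ᴰ D → E ≤ᴰ removeOne G u D
  ≤ᴰ-removeOne {u = u} Eu<Du E≤D v with v ≟ u
  ... | yes refl = ℕ.∸-monoˡ-≤ 1 Eu<Du
  ... | no _     = E≤D v

  applyStep-⊕-single : a ≢ b → 2 ≤ D a →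
                       applyStep G a b D ⊕ single a 2 ≗ D ⊕ single b 1
  applyStep-⊕-single {a} {b} {D} a≢b 2≤Da v with v ≟ a | v ≟ b
  ... | yes refl | yes refl = contradiction refl a≢b
  ... | yes refl | no _     = trans (ℕ.m∸n+n≡m 2≤Da) (sym (ℕ.+-identityʳ (D a)))
  ... | no _     | yes refl = trans (ℕ.+-identityʳ _) (ℕ.+-comm 1 (D b))
  ... | no _     | no _     = refl

  applyStep-mono : ∀ a b → D ≤ᴰ E → applyStep G a b D ≤ᴰ applyStep G a b E
  applyStep-mono a b D≤E v with v ≟ a | v ≟ b
  ... | yes _ | _     = ℕ.∸-monoˡ-≤ 2 (D≤E v)
  ... | no _  | yes _ = s≤s (D≤E v)
  ... | no _  | no _  = D≤E v

  applyStep-≤-off-target : ∀ {v} → v ≢ b → applyStep G a b D v ≤ D v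
  applyStep-≤-off-target {b} {a} {D} {v} v≢b with v ≟ a | v ≟ b
  ... | yes _ | _        = ℕ.m∸n≤m (D v) 2
  ... | no _  | yes v≡b  = contradiction v≡b v≢b
  ... | no _  | no _     = ℕ.≤-refl

  Solvable-mono : D ≤ᴰ E → Solvable G r D → Solvable G r E
  Solvable-mono D≤E (_ , ε , r∈D) = _ , ε , ℕ.≤-trans r∈D (D≤E _)
  Solvable-mono D≤E (_ , pstep a b a~b 2≤Da ◅ steps , r∈D')
    with Solvable-mono (applyStep-mono a b D≤E) (_ , steps , r∈D')
  ... | E' , steps' , r∈E' = E' , pstep a b a~b (ℕ.≤-trans 2≤Da (D≤E a)) ◅ steps' , r∈E'

  critical⇒minimal : Critical G r D → E ≤ᴰ D → Solvable G r E → E ≗ D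
  critical⇒minimal (_ , removal-unsolvable) E≤D E-solvable v =
    ℕ.≤-antisym (E≤D v) (ℕ.≮⇒≥ λ Ev<Dv →
      removal-unsolvable v (ℕ.≤-trans (s≤s z≤n) Ev<Dv)
        (Solvable-mono (≤ᴰ-removeOne Ev<Dv E≤D) E-solvable))

  module Greedy (r : Fin n) (dist : Fin n → ℕ) (isDist : IsDistanceTo G r dist) where

    dist-root : dist r ≡ 0
    dist-root = ℕ.n≤0⇒n≡0 (proj₂ (isDist r) 0 here)

    greedy⇒dist≡suc : Adj a b → dist a > dist b → dist a ≡ suc (dist b)
    greedy⇒dist≡suc a~b a>b =
      ℕ.≤-antisym (proj₂ (isDist _) _ (step a~b (proj₁ (isDist _)))) a>b

    weight≡sum : ∀ D → weight G dist D ≡ sum (λ v → D v /2^ dist v)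
    weight≡sum D = sumℚ≡sum G (λ v → D v /2^ dist v)

    weight-cong : D ≗ E → weight G dist D ≡ weight G dist E
    weight-cong {D} {E} D≗E = trans (weight≡sum D)
      (trans (sum-cong-≗ (λ v → cong (_/2^ dist v) (D≗E v))) (sym (weight≡sum E)))

    weight-⊕ : ∀ D E → weight G dist (D ⊕ E) ≡ weight G dist D ℚ.+ weight G dist E
    weight-⊕ D E = begin
      weight G dist (D ⊕ E)
        ≡⟨ weight≡sum (D ⊕ E) ⟩
      sum (λ v → (D v + E v) /2^ dist v)
        ≡⟨ sum-cong-≗ (λ v → sym (m/2^d+n/2^d≡[m+n]/2^d (D v) (E v) (dist v))) ⟩
      sum (λ v → D v /2^ dist v ℚ.+ E v /2^ dist v)
        ≡⟨ ∑-distrib-+ (λ v → D v /2^ dist v) (λ v → E v /2^ dist v) ⟩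
      sum (λ v → D v /2^ dist v) ℚ.+ sum (λ v → E v /2^ dist v)
        ≡⟨ cong₂ ℚ._+_ (weight≡sum D) (weight≡sum E) ⟨
      weight G dist D ℚ.+ weight G dist E
        ∎
      where open ≡-Reasoning

    weight-single : ∀ u k → weight G dist (single u k) ≡ k /2^ dist u
    weight-single u k = trans (weight≡sum (single u k)) (trans
      (sum-concentrated _ u λ v v≢u →
        trans (cong (_/2^ dist v) (single-other k v≢u)) (0/2^d≡0 (dist v)))
      (cong (_/2^ dist u) (single-self u k)))

    weight-greedy-step : Adj a b → dist a > dist b → 2 ≤ D a →
                         weight G dist (applyStep G a b D) ≡ weight G dist D
    weight-greedy-step {a} {b} {D} a~b a>b 2≤Da =
      ∙-cancelʳ (weight G dist (single a 2)) _ _ (begin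
      weight G dist (applyStep G a b D) ℚ.+ weight G dist (single a 2)
        ≡⟨ weight-⊕ (applyStep G a b D) (single a 2) ⟨
      weight G dist (applyStep G a b D ⊕ single a 2)
        ≡⟨ weight-cong (applyStep-⊕-single (adjacent⇒≢ a~b) 2≤Da) ⟩
      weight G dist (D ⊕ single b 1)
        ≡⟨ weight-⊕ D (single b 1) ⟩
      weight G dist D ℚ.+ weight G dist (single b 1)
        ≡⟨ cong (weight G dist D ℚ.+_) one-at-b≡two-at-a ⟩
      weight G dist D ℚ.+ weight G dist (single a 2)
        ∎)
      where
      open ≡-Reasoning
      one-at-b≡two-at-a : weight G dist (single b 1) ≡ weight G dist (single a 2)
      one-at-b≡two-at-a = begin
        weight G dist (single b 1)  ≡⟨ weight-single b 1 ⟩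
        1 /2^ dist b                ≡⟨ 2/2^[1+d]≡1/2^d (dist b) ⟨
        2 /2^ suc (dist b)          ≡⟨ cong (2 /2^_) (greedy⇒dist≡suc a~b a>b) ⟨
        2 /2^ dist a                ≡⟨ weight-single a 2 ⟨
        weight G dist (single a 2)  ∎

    record Core (D : Distribution G) : Set where
      field
        core          : Distribution G
        core≤         : core ≤ᴰ D
        core-solvable : Solvable G r core
        core-weight   : weight G dist core ≡ 1ℚ

    solved⇒Core : 1 ≤ D r → Core D
    solved⇒Core 1≤Dr = record
      { core          = single r 1
      ; core≤         = single-≤ 1≤Dr
      ; core-solvable = single r 1 , ε , ℕ.≤-reflexive (sym (single-self r 1))
      ; core-weight   = trans (weight-single r 1) (cong (1 /2^_) dist-root)
      }

    Core-undoGreedyStep : Adj a b → dist a > dist b → 2 ≤ D a →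
                    (C : Core (applyStep G a b D)) → 1 ≤ Core.core C b → Core D
    Core-undoGreedyStep {a} {b} {D} a~b a>b 2≤Da C 1≤Cb = record
      { core          = core⁻
      ; core≤         = core⁻≤D
      ; core-solvable = core⁻-solvable
      ; core-weight   = core⁻-weight
      }
      where
      open Core C
      a≢b : a ≢ b
      a≢b = adjacent⇒≢ a~b

      core⁻ : Distribution G
      core⁻ = removeOne G b core ⊕ single a 2

      core⁻⊕b≗core⊕a : core⁻ ⊕ single b 1 ≗ core ⊕ single a 2
      core⁻⊕b≗core⊕a v =
        trans (xy∙z≈xz∙y (removeOne G b core v) (single a 2 v) (single b 1 v))
              (cong (_+ single a 2 v) (removeOne-⊕-single 1≤Cb v))

      2≤core⁻a : 2 ≤ core⁻ a
      2≤core⁻a =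
        subst (λ k → 2 ≤ removeOne G b core a + k) (sym (single-self a 2)) (ℕ.m≤n+m 2 _)

      step-core⁻≗core : applyStep G a b core⁻ ≗ core
      step-core⁻≗core = ⊕-cancelʳ-≗ λ v →
        trans (applyStep-⊕-single a≢b 2≤core⁻a v) (core⁻⊕b≗core⊕a v)

      core⁻≤D : core⁻ ≤ᴰ D
      core⁻≤D = ⊕-cancelʳ-≤ λ v → begin
        core⁻ v + single b 1 v              ≡⟨ core⁻⊕b≗core⊕a v ⟩
        core v + single a 2 v               ≤⟨ ℕ.+-monoˡ-≤ _ (core≤ v) ⟩
        applyStep G a b D v + single a 2 v  ≡⟨ applyStep-⊕-single a≢b 2≤Da v ⟩
        D v + single b 1 v                  ∎
        where open ℕ.≤-Reasoning

      core⁻-solvable : Solvable G r core⁻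
      core⁻-solvable
        with Solvable-mono (ℕ.≤-reflexive ∘ sym ∘ step-core⁻≗core) core-solvable
      ... | C' , steps , r∈C' = C' , pstep a b a~b 2≤core⁻a ◅ steps , r∈C'

      core⁻-weight : weight G dist core⁻ ≡ 1ℚ
      core⁻-weight = begin
        weight G dist core⁻                      ≡⟨ weight-greedy-step a~b a>b 2≤core⁻a ⟨
        weight G dist (applyStep G a b core⁻)    ≡⟨ weight-cong step-core⁻≗core ⟩
        weight G dist core                       ≡⟨ core-weight ⟩
        1ℚ                                       ∎
        where open ≡-Reasoning

    Core-beforeGreedyStep : GStep G dist D D' → Core D' → Core D
    Core-beforeGreedyStep {D} (gstep a b a~b 2≤Da a>b) C with Core.core C b ℕ.≤? D b
    ... | yes Cb≤Db = record { Core C; core≤ = core≤D }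
      where
      open Core C
      core≤D : core ≤ᴰ D
      core≤D v with v ≟ b
      ... | yes refl = Cb≤Db
      ... | no v≢b   = ℕ.≤-trans (core≤ v) (applyStep-≤-off-target v≢b)
    ... | no Cb≰Db =
      Core-undoGreedyStep a~b a>b 2≤Da C (ℕ.≤-trans (s≤s z≤n) (ℕ.≰⇒> Cb≰Db))

    greedySolution⇒Core : Star (GStep G dist) D D' → 1 ≤ D' r → Core D
    greedySolution⇒Core ε            1≤D'r = solved⇒Core 1≤D'r
    greedySolution⇒Core (s ◅ steps) 1≤D'r =
      Core-beforeGreedyStep s (greedySolution⇒Core steps 1≤D'r)

lemma11 : (G : Graph) → Connected G → (r : Fin (Graph.n G)) →
          (dist : Fin (Graph.n G) → ℕ) → IsDistanceTo G r dist →
          (D : Distribution G) → Critical G r D → GreedySolvable G dist r D →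
          weight G dist D ≡ 1ℚ
lemma11 G _ r dist isDist D critical (_ , greedy-solution , 1≤D'r) = begin
  weight G dist D     ≡⟨ weight-cong (critical⇒minimal critical core≤ core-solvable) ⟨
  weight G dist core  ≡⟨ core-weight ⟩
  1ℚ                  ∎
  where
  open Pebbling G
  open Greedy r dist isDist
  open Core (greedySolution⇒Core greedy-solution 1≤D'r)
  open ≡-Reasoning
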